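{- Let $G$ be a graph, $T$ a spanning tree of $G$, and let $G'=G\setminus\operatorname{supp}(\gamma_T)$ be obtained from $G$ by deleting the edges in $\operatorname{supp}(\gamma_T)$. Then $G'$ is the maximal bipartite subgraph of $G$ containing $T$ as a subgraph.
   Context: A graph is connected and finite, loops and multiple edges allowed. $E^c(T)$ is the set of edges not in $T$; $M_2(E^c(T))$ is the $\mathbb Z/2\mathbb Z$-vector space of formal sums $\gamma=\sum_{e\in E^c(T)}c_e e$, and $\operatorname{supp}(\gamma)=\{e:c_e=1\}$. The canonical element $\gamma_T$ has $c_e=0$ if the unique path in $T$ joining the endpoints of $e$ has odd length, and $c_e=1$ otherwise. -}

module Defs where

open import Data.Nat using (ℕ; zero; suc; _≤_)
open import Data.Nat.Base using (_+_)
open import Data.Fin using (Fin)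
open import Data.Bool using (Bool)
open import Data.List using (List; []; _∷_)
open import Data.List.Relation.Unary.Unique.Propositional using (Unique)
open import Data.Product using (Σ; _×_; ∃; _,_)
open import Data.Sum using (_⊎_)
open import Data.Unit using (⊤)
open import Relation.Nullary using (¬_)
open import Relation.Binary.PropositionalEquality using (_≡_; _≢_)
open import Level using (0ℓ)
open import Relation.Unary using (Pred; _⊆_)

-- A finite graph, loops and multiple edges allowed: vertices Fin nV,
-- edges Fin nE, each edge e having endpoints src e and tgt e.
record Graph : Set where
  field
    nV nE : ℕ
    src tgt : Fin nE → Fin nV

module _ (G : Graph) where
  open Graph G

  -- Sets of edges of G (spanning subgraphs of G are given by their edge sets).
  EdgeSet : Set₁
  EdgeSet = Pred (Fin nE) 0ℓ

  AllEdges : EdgeSet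
  AllEdges _ = ⊤

  Joins : Fin nE → Fin nV → Fin nV → Set
  Joins e u v = (src e ≡ u × tgt e ≡ v) ⊎ (src e ≡ v × tgt e ≡ u)

  data Walk (S : EdgeSet) : Fin nV → Fin nV → Set where
    nil  : ∀ v → Walk S v v
    cons : ∀ {u v w} (e : Fin nE) → S e → Joins e u v → Walk S v w → Walk S u w

  wlength : ∀ {S u v} → Walk S u v → ℕ
  wlength (nil _) = 0
  wlength (cons _ _ _ p) = suc (wlength p)

  wedges : ∀ {S u v} → Walk S u v → List (Fin nE)
  wedges (nil _) = []
  wedges (cons e _ _ p) = e ∷ wedges p

  wverts : ∀ {S u v} → Walk S u v → List (Fin nV)
  wverts (nil v) = v ∷ []
  wverts (cons {u = u} _ _ _ p) = u ∷ wverts p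

  IsPath : ∀ {S u v} → Walk S u v → Set
  IsPath p = Unique (wverts p)

  tailVerts : ∀ {S u v} → Walk S u v → List (Fin nV)
  tailVerts (nil _) = []
  tailVerts (cons _ _ _ p) = wverts p

  IsCycle : ∀ {S v} → Walk S v v → Set
  IsCycle p = (1 ≤ wlength p) × Unique (wedges p) × Unique (tailVerts p)

  Connected : EdgeSet → Set
  Connected S = ∀ u v → Walk S u v

  Acyclic : EdgeSet → Set
  Acyclic S = ∀ v → ¬ (Σ (Walk S v v) IsCycle)

  IsSpanningTree : EdgeSet → Set
  IsSpanningTree T = Connected T × Acyclic T

  data Even : ℕ → Set where
    even0  : Even 0
    even+2 : ∀ {k} → Even k → Even (suc (suc k))

  -- supp(γ_T): edges e ∉ T whose (unique) path in T joining the endpoints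
  -- of e has even length (c_e = 1)
  SuppGammaT : EdgeSet → EdgeSet
  SuppGammaT T e = ¬ T e × Σ (Walk T (src e) (tgt e)) (λ p → IsPath p × Even (wlength p))

  DeleteSupp : EdgeSet → EdgeSet
  DeleteSupp T e = ¬ SuppGammaT T e

  Bipartite : EdgeSet → Set
  Bipartite H = Σ (Fin nV → Bool) (λ c → ∀ e → H e → c (src e) ≢ c (tgt e))

  IsMaximumBipartiteContaining : EdgeSet → EdgeSet → Set₁
  IsMaximumBipartiteContaining T H =
    (T ⊆ H) × Bipartite H ×
    (∀ (K : EdgeSet) → T ⊆ K → Bipartite K → K ⊆ H)

{-# OPTIONS --safe #-}
module Submission where

open import Defs
open import Data.Bool using (Bool; true; false)
open import Data.Bool.Properties using (¬-not)
open import Data.Fin using (Fin; zero) renaming (_≟_ to _≟ᶠ_)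
open import Data.Fin.Properties using (¬Fin0)
open import Data.List.Membership.Propositional using (_∈_; _∉_)
open import Data.List.Relation.Unary.All using ([]; lookup)
open import Data.List.Relation.Unary.All.Properties.Core using (¬Any⇒All¬)
open import Data.List.Relation.Unary.Any using (here; there; any?)
open import Data.List.Relation.Unary.AllPairs using ([]; _∷_)
open import Data.List.Relation.Unary.Unique.Propositional using (Unique)
open import Data.Nat using (zero; suc; _+_; _<_; z≤n; s≤s; parity)
open import Data.Nat.Induction using (<-wellFounded)
open import Data.Nat.Properties using (+-suc; m≤m+n; m≤n+m; m<m+n; m<n+m; m<n⇒m<1+n; ≤-trans; ≤-reflexive)
open import Data.Parity.Base as ℙ using (Parity; 0ℙ; 1ℙ)
open import Data.Parity.Properties using (+-homo-+; +-cancelʳ-≡; +-comm; p+p≡0ℙ)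
open import Data.Product using (Σ; ∃₂; _×_; _,_)
open import Data.Sum using (_⊎_; inj₁; inj₂; [_,_])
open import Function using (_∘_)
open import Induction.WellFounded using (Acc; acc)
open import Relation.Nullary using (¬_; Dec; yes; no; contradiction)
open import Relation.Binary.PropositionalEquality
  using (_≡_; _≢_; refl; sym; trans; cong; cong₂; subst; ≢-sym; module ≡-Reasoning)
open import Relation.Unary using (_⊆_)

-- Every closed walk in an acyclic graph has even length: a shortest odd one
-- would be a cycle, since a repeated vertex or a repeated edge cuts a closed
-- walk into two shorter closed walks, one of which is odd.  So in the tree T
-- the parity of a walk from u to v is d u + d v, where d v is the parity of
-- some walk from v to a fixed root.  Colouring by d, an edge of G' with
-- equally coloured ends would be outside T and have an even T-path between
-- its ends, i.e. lie in supp(γ_T).  Conversely, a proper colouring of any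
-- K ⊇ T agrees on the ends of an even T-path, so K avoids supp(γ_T).

toBool : Parity → Bool
toBool 0ℙ = false
toBool 1ℙ = true

toBool-injective : ∀ {p q} → toBool p ≡ toBool q → p ≡ q
toBool-injective {0ℙ} {0ℙ} _ = refl
toBool-injective {1ℙ} {1ℙ} _ = refl

+≡0ℙ⇒≡ : ∀ {p q} → p ℙ.+ q ≡ 0ℙ → p ≡ q
+≡0ℙ⇒≡ {p} {q} p+q≡0 = +-cancelʳ-≡ q p q (trans p+q≡0 (sym (p+p≡0ℙ q)))

≢-≢⇒≡ : ∀ {x y z : Bool} → x ≢ y → y ≢ z → x ≡ z
≢-≢⇒≡ x≢y y≢z = trans (¬-not x≢y) (sym (¬-not (≢-sym y≢z)))

Fin-inhabited? : ∀ n → Dec (Fin n)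
Fin-inhabited? zero    = no ¬Fin0
Fin-inhabited? (suc n) = yes zero

ClosedWalksEven : (G : Graph) → EdgeSet G → Set
ClosedWalksEven G S = ∀ {v} (w : Walk G S v v) → parity (wlength G w) ≡ 0ℙ

module _ (G : Graph) where
  open Graph G

  parity≡0ℙ⇒Even : ∀ n → parity n ≡ 0ℙ → Even G n
  parity≡0ℙ⇒Even zero          _  = even0
  parity≡0ℙ⇒Even (suc zero)    ()
  parity≡0ℙ⇒Even (suc (suc n)) eq = even+2 (parity≡0ℙ⇒Even n eq)

  Joins-unique : ∀ {e u v a b} → Joins G e u v → Joins G e a b → (a ≡ u × b ≡ v) ⊎ (a ≡ v × b ≡ u)
  Joins-unique (inj₁ (refl , refl)) (inj₁ (refl , refl)) = inj₁ (refl , refl)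
  Joins-unique (inj₁ (refl , refl)) (inj₂ (refl , refl)) = inj₂ (refl , refl)
  Joins-unique (inj₂ (refl , refl)) (inj₁ (refl , refl)) = inj₂ (refl , refl)
  Joins-unique (inj₂ (refl , refl)) (inj₂ (refl , refl)) = inj₁ (refl , refl)

  Joins⇒endpoint : ∀ {e u v} → Joins G e u v → u ≡ src e ⊎ u ≡ tgt e
  Joins⇒endpoint (inj₁ (refl , _)) = inj₁ refl
  Joins⇒endpoint (inj₂ (_ , refl)) = inj₂ refl

  bipartite-of-rooted : ∀ {H} → (Fin nV → Bipartite G H) → Bipartite G H
  bipartite-of-rooted bip with Fin-inhabited? nV
  ... | yes r = bip r
  ... | no ¬v = (λ v → contradiction v ¬v) , λ e _ → contradiction (src e) ¬v

  module _ {S : EdgeSet G} where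

    infixr 5 _++_
    _++_ : ∀ {u v w} → Walk G S u v → Walk G S v w → Walk G S u w
    nil _        ++ q = q
    cons e s j p ++ q = cons e s j (p ++ q)

    length-++ : ∀ {u v w} (p : Walk G S u v) (q : Walk G S v w) →
                wlength G (p ++ q) ≡ wlength G p + wlength G q
    length-++ (nil _)        q = refl
    length-++ (cons e s j p) q = cong suc (length-++ p q)

    parity-++ : ∀ {u v w} (p : Walk G S u v) (q : Walk G S v w) →
                parity (wlength G (p ++ q)) ≡ parity (wlength G p) ℙ.+ parity (wlength G q)
    parity-++ p q = trans (cong parity (length-++ p q)) (+-homo-+ (wlength G p) (wlength G q))

    split-at-vertex : ∀ {u x w} (p : Walk G S u w) → x ∈ wverts G p →
                      Σ (Walk G S u x) λ p₁ → Σ (Walk G S x w) λ p₂ → p ≡ p₁ ++ p₂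
    split-at-vertex (nil _)        (here refl) = nil _ , nil _ , refl
    split-at-vertex (cons e s j p) (here refl) = nil _ , cons e s j p , refl
    split-at-vertex (cons e s j p) (there x∈p) with split-at-vertex p x∈p
    ... | p₁ , p₂ , refl = cons e s j p₁ , p₂ , refl

    split-at-edge : ∀ {u w f} (p : Walk G S u w) → f ∈ wedges G p →
                    ∃₂ λ a b → Joins G f a b × Σ (Walk G S u a) λ p₁ → Σ (Walk G S b w) λ p₂ →
                      wlength G p ≡ wlength G p₁ + suc (wlength G p₂)
    split-at-edge (cons f s j p) (here refl) = _ , _ , j , nil _ , p , refl
    split-at-edge (cons e s j p) (there f∈p) with split-at-edge p f∈p
    ... | a , b , k , p₁ , p₂ , eq = a , b , k , cons e s j p₁ , p₂ , cong suc eq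

    IsPath-++⁻ʳ : ∀ {u v w} (p : Walk G S u v) {q : Walk G S v w} → IsPath G (p ++ q) → IsPath G q
    IsPath-++⁻ʳ (nil _)        pq       = pq
    IsPath-++⁻ʳ (cons e s j p) (_ ∷ pq) = IsPath-++⁻ʳ p pq

    start∈wverts : ∀ {u v} (p : Walk G S u v) → u ∈ wverts G p
    start∈wverts (nil _)        = here refl
    start∈wverts (cons _ _ _ _) = here refl

    ∈wedges⇒endpoints∈wverts : ∀ {u v f} (p : Walk G S u v) → f ∈ wedges G p →
                               src f ∈ wverts G p × tgt f ∈ wverts G p
    ∈wedges⇒endpoints∈wverts (cons f s (inj₁ (refl , refl)) p) (here refl) =
      here refl , there (start∈wverts p)
    ∈wedges⇒endpoints∈wverts (cons f s (inj₂ (refl , refl)) p) (here refl) =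
      there (start∈wverts p) , here refl
    ∈wedges⇒endpoints∈wverts (cons e s j p) (there f∈p) with ∈wedges⇒endpoints∈wverts p f∈p
    ... | src∈p , tgt∈p = there src∈p , there tgt∈p

    IsPath⇒Unique-wedges : ∀ {u v} (p : Walk G S u v) → IsPath G p → Unique (wedges G p)
    IsPath⇒Unique-wedges (nil _)                _                = []
    IsPath⇒Unique-wedges (cons {u = u} e s j p) (u∉p ∷ p-path) =
      ¬Any⇒All¬ _ e∉p ∷ IsPath⇒Unique-wedges p p-path
      where
      e∉p : e ∉ wedges G p
      e∉p e∈p with ∈wedges⇒endpoints∈wverts p e∈p
      ... | src∈p , tgt∈p = [ lookup u∉p src∈p , lookup u∉p tgt∈p ] (Joins⇒endpoint j)

    walk⇒path : ∀ {u v} → Walk G S u v → Σ (Walk G S u v) (IsPath G)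
    walk⇒path (nil v) = nil v , [] ∷ []
    walk⇒path {u} (cons e s j p) with walk⇒path p
    ... | p′ , p′-path with any? (u ≟ᶠ_) (wverts G p′)
    ...   | no u∉p′ = cons e s j p′ , ¬Any⇒All¬ _ u∉p′ ∷ p′-path
    ...   | yes u∈p′ with split-at-vertex p′ u∈p′
    ...     | p₁ , p₂ , refl = p₂ , IsPath-++⁻ʳ p₁ p′-path

    record Detour {u w} (p : Walk G S u w) : Set where
      constructor detour
      field
        {x}      : Fin nV
        loop     : Walk G S x x
        loop≢nil : 0 < wlength G loop
        shortcut : Walk G S u w
        length≡  : wlength G p ≡ wlength G loop + wlength G shortcut

    path-or-detour : ∀ {u w} (p : Walk G S u w) → IsPath G p ⊎ Detour p
    path-or-detour (nil v) = inj₁ ([] ∷ [])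
    path-or-detour {u} (cons e s j p) with path-or-detour p
    ... | inj₂ (detour q q≢nil p′ eq) =
      inj₂ (detour q q≢nil (cons e s j p′) (trans (cong suc eq) (sym (+-suc (wlength G q) (wlength G p′)))))
    ... | inj₁ p-path with any? (u ≟ᶠ_) (wverts G p)
    ...   | no u∉p = inj₁ (¬Any⇒All¬ _ u∉p ∷ p-path)
    ...   | yes u∈p with split-at-vertex p u∈p
    ...     | p₁ , p₂ , refl =
      inj₂ (detour (cons e s j p₁) (s≤s z≤n) p₂ (cong suc (length-++ p₁ p₂)))

    record ClosedSplit {v} (w : Walk G S v v) : Set where
      constructor closedSplit
      field
        {a b}        : Fin nV
        w₁           : Walk G S a a
        w₂           : Walk G S b b
        w₁<w         : wlength G w₁ < wlength G w
        w₂<w         : wlength G w₂ < wlength G w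
        parity-split : parity (wlength G w) ≡ parity (wlength G w₁) ℙ.+ parity (wlength G w₂)

    closedSplit-of-sum : ∀ {v a b} {w : Walk G S v v} (w₁ : Walk G S a a) (w₂ : Walk G S b b) →
                         0 < wlength G w₁ → 0 < wlength G w₂ →
                         wlength G w ≡ wlength G w₁ + wlength G w₂ → ClosedSplit w
    closedSplit-of-sum w₁ w₂ w₁≢nil w₂≢nil eq = closedSplit w₁ w₂
      (subst (wlength G w₁ <_) (sym eq) (m<m+n _ w₂≢nil))
      (subst (wlength G w₂ <_) (sym eq) (m<n+m _ w₁≢nil))
      (trans (cong parity eq) (+-homo-+ (wlength G w₁) (wlength G w₂)))

    detour⇒closedSplit : ∀ {u x e} (s : S e) (j : Joins G e u x) (p : Walk G S x u) →
                         Detour p → ClosedSplit (cons e s j p)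
    detour⇒closedSplit s j p (detour q q≢nil p′ eq) =
      closedSplit-of-sum q (cons _ s j p′) q≢nil (s≤s z≤n)
        (trans (cong suc eq) (sym (+-suc (wlength G q) (wlength G p′))))

    -- Cut the closed walk at both traversals of e; which two pieces are closed
    -- depends on the directions in which e is traversed.
    repeated-edge⇒closedSplit : ∀ {u x e} (s : S e) (j : Joins G e u x) (p : Walk G S x u) →
                                e ∈ wedges G p → ClosedSplit (cons e s j p)
    repeated-edge⇒closedSplit s j p e∈p with split-at-edge p e∈p
    ... | a , b , k , p₁ , p₂ , eq with Joins-unique j k
    ...   | inj₁ (refl , refl) =
      closedSplit-of-sum (cons _ s j p₁) (cons _ s j p₂) (s≤s z≤n) (s≤s z≤n) (cong suc eq)
    ...   | inj₂ (refl , refl) = closedSplit p₁ p₂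
      (s≤s (≤-trans (m≤m+n _ _) (≤-reflexive (sym eq))))
      (m<n⇒m<1+n (≤-trans (m≤n+m _ (wlength G p₁)) (≤-reflexive (sym eq))))
      (trans (cong (parity ∘ suc) (trans eq (+-suc (wlength G p₁) (wlength G p₂))))
             (+-homo-+ (wlength G p₁) (wlength G p₂)))

    cycle-or-closedSplit : ∀ {u x e} (s : S e) (j : Joins G e u x) (p : Walk G S x u) →
                           IsCycle G (cons e s j p) ⊎ ClosedSplit (cons e s j p)
    cycle-or-closedSplit {e = e} s j p with path-or-detour p
    ... | inj₂ d = inj₂ (detour⇒closedSplit s j p d)
    ... | inj₁ p-path with any? (e ≟ᶠ_) (wedges G p)
    ...   | yes e∈p = inj₂ (repeated-edge⇒closedSplit s j p e∈p)
    ...   | no e∉p  = inj₁ (s≤s z≤n , ¬Any⇒All¬ _ e∉p ∷ IsPath⇒Unique-wedges p p-path , p-path)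

    acyclic⇒closedWalksEven : Acyclic G S → ClosedWalksEven G S
    acyclic⇒closedWalksEven acyclic w = go w (<-wellFounded (wlength G w))
      where
      go : ∀ {v} (w : Walk G S v v) → Acc _<_ (wlength G w) → parity (wlength G w) ≡ 0ℙ
      go (nil _) _ = refl
      go w@(cons e s j p) (acc rs) with cycle-or-closedSplit s j p
      ... | inj₁ cycle = contradiction (w , cycle) (acyclic _)
      ... | inj₂ (closedSplit w₁ w₂ w₁<w w₂<w split) =
        trans split (cong₂ ℙ._+_ (go w₁ (rs w₁<w)) (go w₂ (rs w₂<w)))

    even-walk⇒same-colour : (c : Fin nV → Bool) → (∀ e → S e → c (src e) ≢ c (tgt e)) →
                            ∀ {u v} (p : Walk G S u v) → Even G (wlength G p) → c u ≡ c v
    even-walk⇒same-colour c proper (nil _) even0 = refl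
    even-walk⇒same-colour c proper (cons e s j (cons f t k p)) (even+2 even) =
      trans (≢-≢⇒≡ (step s j) (step t k)) (even-walk⇒same-colour c proper p even)
      where
      step : ∀ {e u v} → S e → Joins G e u v → c u ≢ c v
      step s (inj₁ (refl , refl)) = proper _ s
      step s (inj₂ (refl , refl)) = proper _ s ∘ sym

  module _ {T : EdgeSet G} (connected : Connected G T) (closedEven : ClosedWalksEven G T)
           (root : Fin nV) where

    depthParity : Fin nV → Parity
    depthParity v = parity (wlength G (connected v root))

    walk-parity : ∀ {u v} (p : Walk G T u v) → parity (wlength G p) ≡ depthParity u ℙ.+ depthParity v
    walk-parity {u} {v} p = trans p≡dv+du (+-comm (depthParity v) (depthParity u))
      where
      open ≡-Reasoning
      back : Walk G T root u
      back = connected root u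
      du≡back : depthParity u ≡ parity (wlength G back)
      du≡back = +≡0ℙ⇒≡
        (trans (sym (parity-++ (connected u root) back)) (closedEven (connected u root ++ back)))
      p≡dv+du : parity (wlength G p) ≡ depthParity v ℙ.+ depthParity u
      p≡dv+du = +≡0ℙ⇒≡ (begin
        parity (wlength G p) ℙ.+ (depthParity v ℙ.+ depthParity u)
          ≡⟨ cong (λ d → parity (wlength G p) ℙ.+ (depthParity v ℙ.+ d)) du≡back ⟩
        parity (wlength G p) ℙ.+ (depthParity v ℙ.+ parity (wlength G back))
          ≡⟨ cong (parity (wlength G p) ℙ.+_) (sym (parity-++ (connected v root) back)) ⟩
        parity (wlength G p) ℙ.+ parity (wlength G (connected v root ++ back))
          ≡⟨ sym (parity-++ p (connected v root ++ back)) ⟩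
        parity (wlength G (p ++ connected v root ++ back))
          ≡⟨ closedEven (p ++ connected v root ++ back) ⟩
        0ℙ ∎)

    deleteSupp-bipartite : Bipartite G (DeleteSupp G T)
    deleteSupp-bipartite = toBool ∘ depthParity , proper
      where
      proper : ∀ e → DeleteSupp G T e → toBool (depthParity (src e)) ≢ toBool (depthParity (tgt e))
      proper e e∉supp same =
        let path , path-isPath = walk⇒path (connected (src e) (tgt e))
        in e∉supp (e∉T , path , path-isPath , parity≡0ℙ⇒Even _ (walks-even path))
        where
        walks-even : (p : Walk G T (src e) (tgt e)) → parity (wlength G p) ≡ 0ℙ
        walks-even p = trans (walk-parity p)
          (trans (cong (ℙ._+ depthParity (tgt e)) (toBool-injective same))
                 (p+p≡0ℙ (depthParity (tgt e))))
        e∉T : ¬ T e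
        e∉T e∈T with walks-even (cons e e∈T (inj₁ (refl , refl)) (nil _))
        ... | ()

  T⊆DeleteSupp : (T : EdgeSet G) → T ⊆ DeleteSupp G T
  T⊆DeleteSupp T e∈T (e∉T , _) = e∉T e∈T

  bipartite⊆DeleteSupp : ∀ {T K : EdgeSet G} → T ⊆ K → Bipartite G K → K ⊆ DeleteSupp G T
  bipartite⊆DeleteSupp T⊆K (c , proper) {e} e∈K (_ , p , _ , even) =
    proper e e∈K (even-walk⇒same-colour c (λ f f∈T → proper f (T⊆K f∈T)) p even)

-- The connectivity hypothesis on G is redundant: it follows from that of T.
lemma6p4 : (G : Graph) → Connected G (AllEdges G) → (T : EdgeSet G) →
    IsSpanningTree G T →
    IsMaximumBipartiteContaining G T (DeleteSupp G T)
lemma6p4 G _ T (connected , acyclic) =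
  T⊆DeleteSupp G T ,
  bipartite-of-rooted G (deleteSupp-bipartite G connected (acyclic⇒closedWalksEven G acyclic)) ,
  λ _ → bipartite⊆DeleteSupp G
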